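{- Let $\mathcal{G}$ be a directed graph, and let $\mathcal{B}$ be a nonempty set of distinct bonds of $\mathcal{G}$ such that the multisets $o(\mathcal{B})$ and $t(\mathcal{B})$ are equal and no vertex occurs more than twice in $o(\mathcal{B})$. Then the number of distinct pseudo orbits on $\mathcal{G}$ containing exactly the bonds of $\mathcal{B}$ (each once) is $2^N$, where $N$ is the number of vertices occurring twice in $o(\mathcal{B})$.
   Context: A bond is a directed edge $b=(v_0,v_1)$ with origin $o(b)=v_0$ and terminus $t(b)=v_1$; for a set $\mathcal{B}=\{b_1,\dots,b_l\}$ of bonds, $o(\mathcal{B})$ is the multiset $\{o(b_1),\dots,o(b_l)\}$ and $t(\mathcal{B})$ is the multiset $\{t(b_1),\dots,t(b_l)\}$. A circuit is a sequence of vertices $v_0,\dots,v_l=v_0$ ($l\ge1$) with each $(v_i,v_{i+1})$ a bond (its bonds counted with repetition); a periodic orbit is an equivalence class of circuits under cyclic rotation; a pseudo orbit is a finite collection of periodic orbits, and the bonds it contains are the bonds of all its periodic orbits counted together. -}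

module Defs where

open import Data.Nat using (ℕ; _≤_)
open import Data.Nat.Properties using (_≟_)
open import Data.Fin using (Fin)
open import Data.Fin.Properties using () renaming (_≟_ to _≟ᶠ_)
open import Data.Product using (_×_; _,_; proj₁; proj₂; ∃; ∃₂)
open import Data.List using (List; []; _∷_; _++_; [_]; zip; map; concatMap; length; filter; allFin)
open import Data.List.Relation.Unary.All using (All)
open import Data.List.Relation.Binary.Permutation.Propositional using (_↭_)
open import Data.List.Relation.Binary.Pointwise using (Pointwise)
open import Relation.Binary.PropositionalEquality using (_≡_)

Graph : ℕ → Set₁
Graph n = Fin n → Fin n → Set

Bond : ℕ → Set
Bond n = Fin n × Fin n

o : ∀ {n} → Bond n → Fin n
o = proj₁

t : ∀ {n} → Bond n → Fin n
t = proj₂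

-- multisets o(B), t(B) as lists (compared up to permutation)
oB : ∀ {n} → List (Bond n) → List (Fin n)
oB = map o

tB : ∀ {n} → List (Bond n) → List (Fin n)
tB = map t

IsBondOf : ∀ {n} → Graph n → Bond n → Set
IsBondOf E b = E (o b) (t b)

occ : ∀ {n} → Fin n → List (Fin n) → ℕ
occ v xs = length (filter (v ≟ᶠ_) xs)

twiceCount : ∀ {n} → List (Bond n) → ℕ
twiceCount {n} B = length (filter (λ v → occ v (oB B) ≟ 2) (allFin n))

-- A circuit v₀, …, v_{l-1}, v_l = v₀ is represented by the list
-- v₀ ∷ … ∷ v_{l-1} (the closing vertex v_l = v₀ is implicit).
-- Its bonds, counted with repetition: (v_i , v_{i+1}) for i < l.
circuitBonds : ∀ {n} → List (Fin n) → List (Bond n)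
circuitBonds [] = []
circuitBonds (v ∷ vs) = zip (v ∷ vs) (vs ++ [ v ])

data NonEmpty {A : Set} : List A → Set where
  nonEmpty : ∀ x xs → NonEmpty (x ∷ xs)

IsCircuit : ∀ {n} → Graph n → List (Fin n) → Set
IsCircuit E c = NonEmpty c × All (IsBondOf E) (circuitBonds c)

-- Two circuits represent the same periodic orbit iff one is a cyclic rotation
-- of the other.
SameOrbit : ∀ {n} → List (Fin n) → List (Fin n) → Set
SameOrbit c c' = ∃₂ λ xs ys → (c ≡ xs ++ ys) × (c' ≡ ys ++ xs)

-- A pseudo orbit: a finite collection (multiset) of periodic orbits, each
-- represented by one of its circuits.
PseudoOrbit : ℕ → Set
PseudoOrbit n = List (List (Fin n))

IsPseudoOrbit : ∀ {n} → Graph n → PseudoOrbit n → Set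
IsPseudoOrbit E p = All (IsCircuit E) p

SamePseudoOrbit : ∀ {n} → PseudoOrbit n → PseudoOrbit n → Set
SamePseudoOrbit p q = ∃ λ r → (p ↭ r) × Pointwise SameOrbit r q

poBonds : ∀ {n} → PseudoOrbit n → List (Bond n)
poBonds = concatMap circuitBonds

PseudoOrbitOn : ∀ {n} → Graph n → List (Bond n) → PseudoOrbit n → Set
PseudoOrbitOn E B p = IsPseudoOrbit E p × (poBonds p ↭ B)

{-# OPTIONS --safe #-}
module Submission where

-- A pseudo orbit using each bond of B once is determined, up to rotating and reordering its
-- circuits, by its successor map: the bond that follows b in its circuit.  This map sends the
-- bonds entering a vertex v bijectively onto the bonds leaving v, so it is forced where v occurs
-- once in o(B) and has exactly two possible values where v occurs twice.  Conversely every such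
-- bijection decomposes B into cycles, which are the circuits of a pseudo orbit.  The pseudo orbits
-- on B therefore correspond to the 2^N ways of deciding, at each doubly visited vertex, whether
-- the two passages through it cross.

open import Defs
open import Data.Bool using (Bool; true; false; not; if_then_else_)
open import Data.Nat using (ℕ; zero; suc; _+_; _^_; _≤_; _<_; s≤s; z≤n)
open import Data.Nat.Properties
  using (_≟_; suc-injective; m≤n⇒m⊓n≡m; m≤m+n; m≤n+m; +-comm; +-suc; +-identityʳ; n<1+n; <⇒≱; 0≢1+n; 1+n≢n)
open import Data.Nat.Induction using (<-wellFounded)
open import Induction.WellFounded using (Acc; acc)
open import Data.Fin using (Fin)
open import Data.Fin.Properties using () renaming (_≟_ to _≟ᶠ_)
open import Data.Product using (Σ; _×_; _,_; proj₁; proj₂; ∃; ∃₂)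
open import Data.Product.Properties using (≡-dec)
open import Data.Sum using (_⊎_; inj₁; inj₂)
open import Data.Empty using (⊥-elim)
open import Function using (_∘_)
open import Data.List
  using (List; []; _∷_; _++_; [_]; _∷ʳ_; zip; map; concat; concatMap; iterate; filter; length; take; drop; allFin)
open import Data.List.Properties
  using (∷-injective; ++-assoc; ++-identityʳ; length-++; length-map; length-take; length-iterate; take++drop≡id; map-++)
open import Data.List.Relation.Binary.Permutation.Propositional
  using (_↭_; ↭-refl; ↭-sym; ↭-trans; ↭-prep; ↭-swap; ↭-reflexive; ↭⇒↭ₛ)
open import Data.List.Relation.Binary.Permutation.Propositional.Properties
  using (++-comm; ∷↭∷ʳ; shift; shifts; drop-∷; ++⁺ˡ; ++⁺ʳ; ++⁺; ∈-resp-↭; All-resp-↭; ↭-length; filter-↭)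
import Data.List.Relation.Binary.Permutation.Setoid.Properties as ↭ₛ
open import Data.List.Relation.Binary.Pointwise using (Pointwise; []; _∷_)
open import Data.List.Relation.Binary.Subset.Propositional using (_⊆_)
open import Data.List.Relation.Unary.All as All using (All; []; _∷_)
import Data.List.Relation.Unary.All.Properties as All
open import Data.List.Relation.Unary.Any as Any using (Any; here; there)
import Data.List.Relation.Unary.Any.Properties as Any
open import Data.List.Relation.Unary.AllPairs as AllPairs using (AllPairs; []; _∷_)
import Data.List.Relation.Unary.AllPairs.Properties as AllPairs
open import Data.List.Relation.Unary.Unique.Propositional using (Unique)
import Data.List.Relation.Unary.Unique.Propositional.Properties as Unique
open import Data.List.Membership.Propositional using (_∈_; _∉_; find)
open import Data.List.Membership.Propositional.Properties
  using (∈-++⁺ˡ; ∈-++⁺ʳ; ∈-++⁻; ∈-∃++; ∈-map⁺; ∈-map⁻; ∈-concat⁺′; ∈-concatMap⁻; ∈-filter⁺; ∈-filter⁻; ∈-allFin)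
import Data.List.Membership.DecPropositional as DecMembership
open import Relation.Binary using (DecidableEquality)
open import Relation.Binary.PropositionalEquality
  using (_≡_; _≢_; refl; sym; trans; cong; cong₂; subst; subst₂; setoid; module ≡-Reasoning)
open import Relation.Nullary using (¬_; Dec; yes; no; does)
open import Relation.Nullary.Decidable using (dec-true; dec-false)

module _ {A : Set} where

  Unique-resp-↭ : {xs ys : List A} → xs ↭ ys → Unique xs → Unique ys
  Unique-resp-↭ p = ↭ₛ.Unique-resp-↭ (setoid A) (↭⇒↭ₛ p)

  Unique-++⁻ˡ : ∀ xs {ys : List A} → Unique (xs ++ ys) → Unique xs
  Unique-++⁻ˡ []       _          = []
  Unique-++⁻ˡ (x ∷ xs) (x∉ ∷ xs!) = All.++⁻ˡ xs x∉ ∷ Unique-++⁻ˡ xs xs!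

  Unique-++⁻ʳ : ∀ xs {ys : List A} → Unique (xs ++ ys) → Unique ys
  Unique-++⁻ʳ []       ys!       = ys!
  Unique-++⁻ʳ (x ∷ xs) (_ ∷ xs!) = Unique-++⁻ʳ xs xs!

  Unique-++⇒∉ : ∀ xs {ys : List A} {x} → Unique (xs ++ ys) → x ∈ xs → x ∉ ys
  Unique-++⇒∉ (x ∷ xs) (x∉ ∷ _)  (here refl)  x∈ys = All.lookup x∉ (∈-++⁺ʳ xs x∈ys) refl
  Unique-++⇒∉ (x ∷ xs) (_ ∷ xs!) (there x∈xs)      = Unique-++⇒∉ xs xs! x∈xs

  Unique-∷ʳ : ∀ {xs : List A} {x} → Unique xs → x ∉ xs → Unique (xs ∷ʳ x)
  Unique-∷ʳ xs! x∉xs = Unique.++⁺ xs! (All.[] ∷ []) λ { (x∈xs , here refl) → x∉xs x∈xs }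

  Unique∧⊆⇒↭++ : {xs ys : List A} → Unique xs → xs ⊆ ys → ∃ λ zs → ys ↭ xs ++ zs
  Unique∧⊆⇒↭++ {[]}     {ys} _ _ = ys , ↭-refl
  Unique∧⊆⇒↭++ {x ∷ xs} (x∉ ∷ xs!) xs⊆ys with ∈-∃++ (xs⊆ys (here refl))
  ... | ys₁ , ys₂ , refl =
    let zs , ys₁++ys₂↭ = Unique∧⊆⇒↭++ xs! xs⊆ys₁++ys₂
    in  zs , ↭-trans (shift x ys₁ ys₂) (↭-prep x ys₁++ys₂↭)
    where
    xs⊆ys₁++ys₂ : xs ⊆ ys₁ ++ ys₂
    xs⊆ys₁++ys₂ {a} a∈xs with ∈-resp-↭ (shift x ys₁ ys₂) (xs⊆ys (there a∈xs))
    ... | here refl = ⊥-elim (All.lookup x∉ a∈xs refl)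
    ... | there a∈ = a∈

  Unique∧⊆⇒length≤ : {xs ys : List A} → Unique xs → xs ⊆ ys → length xs ≤ length ys
  Unique∧⊆⇒length≤ {xs} xs! xs⊆ys with Unique∧⊆⇒↭++ xs! xs⊆ys
  ... | zs , ys↭ = subst (length xs ≤_) (sym (trans (↭-length ys↭) (length-++ xs))) (m≤m+n _ _)

  ++-cancelˡ-↭ : ∀ xs {ys zs : List A} → xs ++ ys ↭ xs ++ zs → ys ↭ zs
  ++-cancelˡ-↭ []       p = p
  ++-cancelˡ-↭ (x ∷ xs) p = ++-cancelˡ-↭ xs (drop-∷ p)

  InjectiveOn : {B : Set} → (A → B) → List A → Set
  InjectiveOn f xs = ∀ {x y} → x ∈ xs → y ∈ xs → f x ≡ f y → x ≡ y

  Unique-map⇒InjectiveOn : {B : Set} (f : A → B) {xs : List A} → Unique (map f xs) → InjectiveOn f xs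
  Unique-map⇒InjectiveOn f (_ ∷ _)     (here refl) (here refl) _     = refl
  Unique-map⇒InjectiveOn f (fx∉ ∷ _)   (here refl) (there y∈)  fx≡fy = ⊥-elim (All.lookup fx∉ (∈-map⁺ f y∈) fx≡fy)
  Unique-map⇒InjectiveOn f (fy∉ ∷ _)   (there x∈)  (here refl) fx≡fy =
    ⊥-elim (All.lookup fy∉ (∈-map⁺ f x∈) (sym fx≡fy))
  Unique-map⇒InjectiveOn f (_ ∷ fxs!)  (there x∈)  (there y∈)  fx≡fy = Unique-map⇒InjectiveOn f fxs! x∈ y∈ fx≡fy

  concatMap-↭ : {B : Set} (f : A → List B) {xs ys : List A} → xs ↭ ys → concatMap f xs ↭ concatMap f ys
  concatMap-↭ f _↭_.refl         = ↭-refl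
  concatMap-↭ f (_↭_.prep x p)   = ++⁺ˡ (f x) (concatMap-↭ f p)
  concatMap-↭ f (_↭_.swap x y p) = ↭-trans (shifts (f x) (f y)) (++⁺ˡ (f y) (++⁺ˡ (f x) (concatMap-↭ f p)))
  concatMap-↭ f (_↭_.trans p q)  = ↭-trans (concatMap-↭ f p) (concatMap-↭ f q)

  Pointwise-↭ʳ : {B : Set} {R : A → B → Set} {xs : List A} {ys zs : List B} →
                 Pointwise R xs ys → ys ↭ zs → ∃ λ xs′ → xs ↭ xs′ × Pointwise R xs′ zs
  Pointwise-↭ʳ {xs = xs} rs _↭_.refl = xs , ↭-refl , rs
  Pointwise-↭ʳ (r ∷ rs) (_↭_.prep _ p) =
    let xs′ , q , rs′ = Pointwise-↭ʳ rs p in _ , ↭-prep _ q , r ∷ rs′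
  Pointwise-↭ʳ (r₁ ∷ r₂ ∷ rs) (_↭_.swap _ _ p) =
    let xs′ , q , rs′ = Pointwise-↭ʳ rs p in _ , ↭-swap _ _ q , r₂ ∷ r₁ ∷ rs′
  Pointwise-↭ʳ rs (_↭_.trans p₁ p₂) =
    let xs₁ , q₁ , rs₁ = Pointwise-↭ʳ rs p₁
        xs₂ , q₂ , rs₂ = Pointwise-↭ʳ rs₁ p₂
    in  xs₂ , ↭-trans q₁ q₂ , rs₂

module _ {A B : Set} where

  map-proj₁-zip : (xs : List A) (ys : List B) → length xs ≡ length ys → map proj₁ (zip xs ys) ≡ xs
  map-proj₁-zip []       []       _  = refl
  map-proj₁-zip (x ∷ xs) (y ∷ ys) eq = cong (x ∷_) (map-proj₁-zip xs ys (suc-injective eq))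

  map-proj₂-zip : (xs : List A) (ys : List B) → length xs ≡ length ys → map proj₂ (zip xs ys) ≡ ys
  map-proj₂-zip []       []       _  = refl
  map-proj₂-zip (x ∷ xs) (y ∷ ys) eq = cong (y ∷_) (map-proj₂-zip xs ys (suc-injective eq))

  zip-++ : (xs : List A) (ys : List B) {xs′ : List A} {ys′ : List B} → length xs ≡ length ys →
           zip (xs ++ xs′) (ys ++ ys′) ≡ zip xs ys ++ zip xs′ ys′
  zip-++ []       []       _  = refl
  zip-++ (x ∷ xs) (y ∷ ys) eq = cong ((x , y) ∷_) (zip-++ xs ys (suc-injective eq))

length-filter-map : ∀ {n} {A : Set} (y : Fin n) (g : A → Fin n) (xs : List A) →
                    length (filter (λ x → y ≟ᶠ g x) xs) ≡ length (filter (y ≟ᶠ_) (map g xs))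
length-filter-map y g []       = refl
length-filter-map y g (x ∷ xs) with y ≟ᶠ g x
... | yes _ = cong suc (length-filter-map y g xs)
... | no  _ = length-filter-map y g xs

module _ {A : Set} where

  length≡1 : {xs : List A} → length xs ≡ 1 → ∃ λ x → xs ≡ [ x ]
  length≡1 {x ∷ []} refl = x , refl

  length≡2 : {xs : List A} → length xs ≡ 2 → ∃₂ λ x y → xs ≡ x ∷ y ∷ []
  length≡2 {x ∷ y ∷ []} refl = x , y , refl

  ∈-pair : ∀ {a x y : A} → a ∈ x ∷ y ∷ [] → a ≡ x ⊎ a ≡ y
  ∈-pair (here a≡x)         = inj₁ a≡x
  ∈-pair (there (here a≡y)) = inj₂ a≡y

  if-∈ : ∀ s {x y : A} {zs} → x ∈ zs → y ∈ zs → (if s then x else y) ∈ zs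
  if-∈ true  x∈ _  = x∈
  if-∈ false _  y∈ = y∈

  if-≢ : ∀ {s s′} {x y : A} → x ≢ y → s ≢ s′ → (if s then y else x) ≢ (if s′ then y else x)
  if-≢ {false} {false} _   s≢s′ = ⊥-elim (s≢s′ refl)
  if-≢ {false} {true}  x≢y _    = x≢y
  if-≢ {true}  {false} x≢y _    = x≢y ∘ sym
  if-≢ {true}  {true}  _   s≢s′ = ⊥-elim (s≢s′ refl)

  if-swap-≢ : ∀ s {x y : A} → x ≢ y → (if s then y else x) ≢ (if s then x else y)
  if-swap-≢ false x≢y = x≢y
  if-swap-≢ true  x≢y = x≢y ∘ sym

  if-other : ∀ s {a x y : A} → a ∈ x ∷ y ∷ [] → a ≢ (if s then y else x) → a ≡ (if s then x else y)
  if-other false a∈ a≢x with ∈-pair a∈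
  ... | inj₁ a≡x = ⊥-elim (a≢x a≡x)
  ... | inj₂ a≡y = a≡y
  if-other true a∈ a≢y with ∈-pair a∈
  ... | inj₁ a≡x = a≡x
  ... | inj₂ a≡y = ⊥-elim (a≢y a≡y)

module _ {A : Set} where

  -- On lists of vertices this is, definitionally, SameOrbit.
  Rotation : List A → List A → Set
  Rotation xs ys = ∃₂ λ us vs → xs ≡ us ++ vs × ys ≡ vs ++ us

  Rotation⇒↭ : {xs ys : List A} → Rotation xs ys → xs ↭ ys
  Rotation⇒↭ (us , vs , refl , refl) = ++-comm us vs

  rotate₁ : List A → List A
  rotate₁ []       = []
  rotate₁ (x ∷ xs) = xs ∷ʳ x

  rotate : ℕ → List A → List A
  rotate zero    xs = xs
  rotate (suc k) xs = rotate k (rotate₁ xs)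

  rotate₁-↭ : (xs : List A) → rotate₁ xs ↭ xs
  rotate₁-↭ []       = ↭-refl
  rotate₁-↭ (x ∷ xs) = ↭-sym (∷↭∷ʳ x xs)

  rotate-++ : (xs ys : List A) → rotate (length xs) (xs ++ ys) ≡ ys ++ xs
  rotate-++ []       ys = sym (++-identityʳ ys)
  rotate-++ (x ∷ xs) ys = begin
    rotate (length xs) ((xs ++ ys) ∷ʳ x)  ≡⟨ cong (rotate (length xs)) (++-assoc xs ys [ x ]) ⟩
    rotate (length xs) (xs ++ ys ∷ʳ x)    ≡⟨ rotate-++ xs (ys ∷ʳ x) ⟩
    (ys ∷ʳ x) ++ xs                       ≡⟨ ++-assoc ys [ x ] xs ⟩
    ys ++ x ∷ xs                          ∎
    where open ≡-Reasoning

  rotate-Rotation : ∀ k (xs : List A) → k ≤ length xs → Rotation xs (rotate k xs)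
  rotate-Rotation k xs k≤ = take k xs , drop k xs , sym (take++drop≡id k xs) , (begin
    rotate k xs                                          ≡⟨ cong₂ rotate (sym length-take-k) (sym split) ⟩
    rotate (length (take k xs)) (take k xs ++ drop k xs) ≡⟨ rotate-++ (take k xs) (drop k xs) ⟩
    drop k xs ++ take k xs                               ∎)
    where
    open ≡-Reasoning
    split = take++drop≡id k xs
    length-take-k : length (take k xs) ≡ k
    length-take-k = trans (length-take k xs) (m≤n⇒m⊓n≡m k≤)

module _ {A : Set} where

  length-∷ʳ : (xs : List A) (x : A) → length (xs ∷ʳ x) ≡ suc (length xs)
  length-∷ʳ xs x = trans (length-++ xs) (+-comm (length xs) 1)

  cyclicPairs : List A → List (A × A)
  cyclicPairs []       = []
  cyclicPairs (x ∷ xs) = zip (x ∷ xs) (xs ∷ʳ x)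

  map-proj₁-cyclicPairs : (xs : List A) → map proj₁ (cyclicPairs xs) ≡ xs
  map-proj₁-cyclicPairs []       = refl
  map-proj₁-cyclicPairs (x ∷ xs) = map-proj₁-zip (x ∷ xs) (xs ∷ʳ x) (sym (length-∷ʳ xs x))

  map-proj₂-cyclicPairs : (xs : List A) → map proj₂ (cyclicPairs xs) ≡ rotate₁ xs
  map-proj₂-cyclicPairs []       = refl
  map-proj₂-cyclicPairs (x ∷ xs) = map-proj₂-zip (x ∷ xs) (xs ∷ʳ x) (sym (length-∷ʳ xs x))

  length-cyclicPairs : (xs : List A) → length (cyclicPairs xs) ≡ length xs
  length-cyclicPairs xs =
    trans (sym (length-map proj₁ (cyclicPairs xs))) (cong length (map-proj₁-cyclicPairs xs))

  cyclicPairs-rotate₁ : (xs : List A) → cyclicPairs (rotate₁ xs) ≡ rotate₁ (cyclicPairs xs)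
  cyclicPairs-rotate₁ []           = refl
  cyclicPairs-rotate₁ (x ∷ [])     = refl
  cyclicPairs-rotate₁ (x ∷ y ∷ zs) = zip-++ (y ∷ zs) (zs ∷ʳ x) (sym (length-∷ʳ zs x))

  cyclicPairs-rotate : ∀ k (xs : List A) → cyclicPairs (rotate k xs) ≡ rotate k (cyclicPairs xs)
  cyclicPairs-rotate zero    xs = refl
  cyclicPairs-rotate (suc k) xs =
    trans (cyclicPairs-rotate k (rotate₁ xs)) (cong (rotate k) (cyclicPairs-rotate₁ xs))

  cyclicPairs-Rotation : {xs ys : List A} → Rotation xs ys → Rotation (cyclicPairs xs) (cyclicPairs ys)
  cyclicPairs-Rotation (us , vs , refl , refl) =
    subst (Rotation (cyclicPairs (us ++ vs))) (sym cyclicPairs-vs++us)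
      (rotate-Rotation (length us) (cyclicPairs (us ++ vs)) k≤)
    where
    cyclicPairs-vs++us : cyclicPairs (vs ++ us) ≡ rotate (length us) (cyclicPairs (us ++ vs))
    cyclicPairs-vs++us =
      trans (cong cyclicPairs (sym (rotate-++ us vs))) (cyclicPairs-rotate (length us) (us ++ vs))
    k≤ : length us ≤ length (cyclicPairs (us ++ vs))
    k≤ = subst (length us ≤_) (sym (trans (length-cyclicPairs (us ++ vs)) (length-++ us))) (m≤m+n _ _)

  ∈-cyclicPairs⇒Rotation : ∀ {p} {xs : List A} → p ∈ cyclicPairs xs →
                           ∃ λ ys → Rotation xs ys × ∃ λ ps → cyclicPairs ys ≡ p ∷ ps
  ∈-cyclicPairs⇒Rotation {p} {xs} p∈ with ∈-∃++ p∈
  ... | as , bs , eq = rotate (length as) xs , rotate-Rotation (length as) xs k≤ , bs ++ as , (begin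
    cyclicPairs (rotate (length as) xs)   ≡⟨ cyclicPairs-rotate (length as) xs ⟩
    rotate (length as) (cyclicPairs xs)   ≡⟨ cong (rotate (length as)) eq ⟩
    rotate (length as) (as ++ p ∷ bs)     ≡⟨ rotate-++ as (p ∷ bs) ⟩
    p ∷ bs ++ as                          ∎)
    where
    open ≡-Reasoning
    k≤ : length as ≤ length xs
    k≤ = subst (length as ≤_)
           (trans (sym (length-++ as)) (trans (cong length (sym eq)) (length-cyclicPairs xs)))
           (m≤m+n _ _)

  cyclicPairs≡zip-rotate₁ : (xs : List A) → cyclicPairs xs ≡ zip xs (rotate₁ xs)
  cyclicPairs≡zip-rotate₁ []      = refl
  cyclicPairs≡zip-rotate₁ (_ ∷ _) = refl

  proj₁-∈-cyclicPairs : ∀ {a b} {xs : List A} → (a , b) ∈ cyclicPairs xs → a ∈ xs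
  proj₁-∈-cyclicPairs {xs = xs} ab∈ = subst (_ ∈_) (map-proj₁-cyclicPairs xs) (∈-map⁺ proj₁ ab∈)

-- Cycles of a self-map
module _ {A : Set} (f : A → A) where

  Step : A × A → Set
  Step (a , b) = b ≡ f a

  IsCycle : List A → Set
  IsCycle xs = All Step (cyclicPairs xs)

  IsCycle-Rotation : {xs ys : List A} → Rotation xs ys → IsCycle xs → IsCycle ys
  IsCycle-Rotation r = All-resp-↭ (Rotation⇒↭ (cyclicPairs-Rotation r))

  IsCycle⇒preimage : {xs : List A} → IsCycle xs → ∀ {y} → y ∈ xs → ∃ λ x → x ∈ xs × f x ≡ y
  IsCycle⇒preimage {xs} steps y∈xs with ∈-map⁻ proj₂ y∈pairs
    where
    y∈pairs : _ ∈ map proj₂ (cyclicPairs xs)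
    y∈pairs = subst (_ ∈_) (sym (map-proj₂-cyclicPairs xs)) (∈-resp-↭ (↭-sym (rotate₁-↭ xs)) y∈xs)
  ... | (x , y) , xy∈ , refl =
    x , subst (x ∈_) (map-proj₁-cyclicPairs xs) (∈-map⁺ proj₁ xy∈) , sym (All.lookup steps xy∈)

  paths-unique : ∀ a z {xs ys : List A} → z ∉ xs → z ∉ ys →
                 All Step (zip (a ∷ xs) (xs ∷ʳ z)) → All Step (zip (a ∷ ys) (ys ∷ʳ z)) → xs ≡ ys
  paths-unique a z {[]}     {[]}     _    _    _                 _                 = refl
  paths-unique a z {[]}     {y ∷ ys} _    z∉ys (z≡fa ∷ [])       (refl ∷ _)        = ⊥-elim (z∉ys (here z≡fa))
  paths-unique a z {x ∷ xs} {[]}     z∉xs _    (refl ∷ _)        (z≡fa ∷ [])       = ⊥-elim (z∉xs (here z≡fa))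
  paths-unique a z {x ∷ xs} {y ∷ ys} z∉xs z∉ys (refl ∷ xs-steps) (refl ∷ ys-steps) =
    cong (f a ∷_) (paths-unique (f a) z (z∉xs ∘ there) (z∉ys ∘ there) xs-steps ys-steps)

  IsCycle-unique : ∀ a {xs ys : List A} → Unique (a ∷ xs) → Unique (a ∷ ys) →
                   IsCycle (a ∷ xs) → IsCycle (a ∷ ys) → xs ≡ ys
  IsCycle-unique a axs! ays! =
    paths-unique a a (Unique.Unique[x∷xs]⇒x∉xs axs!) (Unique.Unique[x∷xs]⇒x∉xs ays!)

  iter : ℕ → A → A
  iter zero    x = x
  iter (suc k) x = iter k (f x)

  iter-suc : ∀ k x → iter (suc k) x ≡ f (iter k x)
  iter-suc zero    x = refl
  iter-suc (suc k) x = iter-suc k (f x)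

  iterate-suc : ∀ k x → iterate f x (suc k) ≡ iterate f x k ∷ʳ iter k x
  iterate-suc zero    x = refl
  iterate-suc (suc k) x = cong (x ∷_) (iterate-suc k (f x))

  ∈-iterate⁻ : ∀ {a} k x → a ∈ iterate f x k → ∃ λ i → i < k × a ≡ iter i x
  ∈-iterate⁻ (suc k) x (here refl) = 0 , s≤s z≤n , refl
  ∈-iterate⁻ (suc k) x (there a∈) with ∈-iterate⁻ k (f x) a∈
  ... | i , i<k , refl = suc i , s≤s i<k , refl

  ∈-iterate⁺ : ∀ {i} k x → i < k → iter i x ∈ iterate f x k
  ∈-iterate⁺ {zero}  (suc k) x _         = here refl
  ∈-iterate⁺ {suc i} (suc k) x (s≤s i<k) = there (∈-iterate⁺ k (f x) i<k)

  IsCycle-iterate : ∀ k x → iter (suc k) x ≡ x → IsCycle (iterate f x (suc k))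
  IsCycle-iterate k x returns = steps k x returns
    where
    steps : ∀ k y → iter (suc k) y ≡ x → All Step (zip (y ∷ iterate f (f y) k) (iterate f (f y) k ∷ʳ x))
    steps zero    y eq = sym eq ∷ []
    steps (suc k) y eq = refl ∷ steps k (f y) eq

  Invariant : List A → Set
  Invariant R = ∀ {a} → a ∈ R → f a ∈ R

  module _ (_≟_ : DecidableEquality A) {R : List A} (inv : Invariant R) (inj : InjectiveOn f R) where

    open DecMembership _≟_ using (_∈?_)

    iter-∈ : ∀ k {x} → x ∈ R → iter k x ∈ R
    iter-∈ zero    x∈R = x∈R
    iter-∈ (suc k) x∈R = iter-∈ k (inv x∈R)

    iterate-⊆ : ∀ k {x} → x ∈ R → iterate f x k ⊆ R
    iterate-⊆ k {x} x∈R a∈ with ∈-iterate⁻ k x a∈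
    ... | i , _ , refl = iter-∈ i x∈R

    first-repetition : ∀ k {x} → x ∈ R → Unique (iterate f x (suc k)) →
                       iter (suc k) x ∈ iterate f x (suc k) → iter (suc k) x ≡ x
    first-repetition k {x} x∈R path! repeated with ∈-iterate⁻ (suc k) x repeated
    ... | zero  , _       , eq = eq
    ... | suc j , s≤s j<k , eq =
      ⊥-elim (iter-k∉ (subst (_∈ iterate f x k) iter-j≡iter-k (∈-iterate⁺ k x j<k)))
      where
      iter-k∉ : iter k x ∉ iterate f x k
      iter-k∉ iter-k∈ =
        Unique-++⇒∉ (iterate f x k) (subst Unique (iterate-suc k x) path!) iter-k∈ (here refl)
      iter-j≡iter-k : iter j x ≡ iter k x
      iter-j≡iter-k = inj (iter-∈ j x∈R) (iter-∈ k x∈R)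
                        (trans (sym (iter-suc j x)) (trans (sym eq) (iter-suc k x)))

    orbit : ∀ {x} → x ∈ R → ∃ λ k → Unique (iterate f x (suc k)) × iter (suc k) x ≡ x
    orbit {x} x∈R = search (length R) 0 (n<1+n (length R)) ([] ∷ [])
      where
      search : ∀ fuel k → length R < suc k + fuel → Unique (iterate f x (suc k)) →
               ∃ λ k → Unique (iterate f x (suc k)) × iter (suc k) x ≡ x
      search zero k bound path! = ⊥-elim (<⇒≱ (subst (length R <_) (+-identityʳ (suc k)) bound) path-fits)
        where
        path-fits : suc k ≤ length R
        path-fits = subst (_≤ length R) (length-iterate f x (suc k))
                      (Unique∧⊆⇒length≤ path! (iterate-⊆ (suc k) x∈R))
      search (suc fuel) k bound path! with iter (suc k) x ∈? iterate f x (suc k)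
      ... | yes repeated = k , path! , first-repetition k x∈R path! repeated
      ... | no fresh     = search fuel (suc k) (subst (length R <_) (+-suc (suc k) fuel) bound)
                             (subst Unique (sym (iterate-suc (suc k) x)) (Unique-∷ʳ path! fresh))

  cycle-decomposition : DecidableEquality A → (R : List A) → Unique R → Invariant R → InjectiveOn f R →
                        ∃ λ cs → concat cs ↭ R × All (λ c → NonEmpty c × IsCycle c) cs
  cycle-decomposition _≟_ R = go R (<-wellFounded (length R))
    where
    go : (R : List A) → Acc _<_ (length R) → Unique R → Invariant R → InjectiveOn f R →
         ∃ λ cs → concat cs ↭ R × All (λ c → NonEmpty c × IsCycle c) cs
    go []        _         _  _   _   = [] , ↭-refl , []
    go R@(x ∷ _) (acc rec) R! inv inj with orbit _≟_ inv inj (here refl)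
    ... | k , O! , returns with Unique∧⊆⇒↭++ O! (iterate-⊆ _≟_ inv inj (suc k) (here refl))
    ... | R′ , R↭O++R′ =
      let cs , cs↭R′ , cycles = go R′ (rec shorter) R′! inv′ (λ a∈ b∈ → inj (R′⊆R a∈) (R′⊆R b∈))
      in  O ∷ cs , ↭-trans (++⁺ˡ O cs↭R′) (↭-sym R↭O++R′) , (nonEmpty _ _ , O-cycle) ∷ cycles
      where
      O = iterate f x (suc k)
      O-cycle : IsCycle O
      O-cycle = IsCycle-iterate k x returns
      O++R′! : Unique (O ++ R′)
      O++R′! = Unique-resp-↭ R↭O++R′ R!
      R′! : Unique R′
      R′! = Unique-++⁻ʳ O O++R′!
      O⊆R : O ⊆ R
      O⊆R a∈ = ∈-resp-↭ (↭-sym R↭O++R′) (∈-++⁺ˡ a∈)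
      R′⊆R : R′ ⊆ R
      R′⊆R a∈ = ∈-resp-↭ (↭-sym R↭O++R′) (∈-++⁺ʳ O a∈)
      -- A preimage in O of an image f a ∈ O would, by injectivity, put a in O.
      inv′ : Invariant R′
      inv′ {a} a∈R′ with ∈-++⁻ O (∈-resp-↭ R↭O++R′ (inv (R′⊆R a∈R′)))
      ... | inj₂ fa∈R′ = fa∈R′
      ... | inj₁ fa∈O with IsCycle⇒preimage O-cycle fa∈O
      ...   | b , b∈O , fb≡fa =
        ⊥-elim (Unique-++⇒∉ O O++R′! (subst (_∈ O) (inj (O⊆R b∈O) (R′⊆R a∈R′) fb≡fa) b∈O) a∈R′)
      shorter : length R′ < length R
      shorter = subst (length R′ <_) (sym length-R) (s≤s (m≤n+m (length R′) k))
        where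
        length-R : length R ≡ suc k + length R′
        length-R = trans (↭-length R↭O++R′)
                     (trans (length-++ O) (cong (_+ length R′) (length-iterate f x (suc k))))

-- Pseudo orbits following a successor map
module _ {n : ℕ} where

  circuitBonds≡cyclicPairs : (c : List (Fin n)) → circuitBonds c ≡ cyclicPairs c
  circuitBonds≡cyclicPairs []      = refl
  circuitBonds≡cyclicPairs (_ ∷ _) = refl

  circuitBonds-Rotation : {c c′ : List (Fin n)} → SameOrbit c c′ →
                          Rotation (circuitBonds c) (circuitBonds c′)
  circuitBonds-Rotation {c} {c′} r = subst₂ Rotation (sym (circuitBonds≡cyclicPairs c))
                                       (sym (circuitBonds≡cyclicPairs c′)) (cyclicPairs-Rotation r)

  circuitBonds-injective : {c c′ : List (Fin n)} → circuitBonds c ≡ circuitBonds c′ → c ≡ c′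
  circuitBonds-injective {c} {c′} eq = begin
    c                           ≡⟨ sym (map-proj₁-cyclicPairs c) ⟩
    map proj₁ (cyclicPairs c)   ≡⟨ cong (map proj₁) (sym (circuitBonds≡cyclicPairs c)) ⟩
    map proj₁ (circuitBonds c)  ≡⟨ cong (map proj₁) eq ⟩
    map proj₁ (circuitBonds c′) ≡⟨ cong (map proj₁) (circuitBonds≡cyclicPairs c′) ⟩
    map proj₁ (cyclicPairs c′)  ≡⟨ map-proj₁-cyclicPairs c′ ⟩
    c′                          ∎
    where open ≡-Reasoning

  circuitBonds-nonEmpty : {c : List (Fin n)} → NonEmpty c → ∃₂ λ β bs → circuitBonds c ≡ β ∷ bs
  circuitBonds-nonEmpty (nonEmpty v [])       = (v , v) , [] , refl
  circuitBonds-nonEmpty (nonEmpty v (w ∷ ws)) = (v , w) , _ , refl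

  transitions : PseudoOrbit n → List (Bond n × Bond n)
  transitions = concatMap (cyclicPairs ∘ circuitBonds)

  map-proj₁-transitions : (p : PseudoOrbit n) → map proj₁ (transitions p) ≡ poBonds p
  map-proj₁-transitions []      = refl
  map-proj₁-transitions (c ∷ p) = trans (map-++ proj₁ (cyclicPairs (circuitBonds c)) (transitions p))
    (cong₂ _++_ (map-proj₁-cyclicPairs (circuitBonds c)) (map-proj₁-transitions p))

  map-proj₂-transitions : (p : PseudoOrbit n) → map proj₂ (transitions p) ↭ poBonds p
  map-proj₂-transitions []      = ↭-refl
  map-proj₂-transitions (c ∷ p) =
    ↭-trans (↭-reflexive (map-++ proj₂ (cyclicPairs (circuitBonds c)) (transitions p)))
      (++⁺ (↭-trans (↭-reflexive (map-proj₂-cyclicPairs (circuitBonds c))) (rotate₁-↭ (circuitBonds c)))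
           (map-proj₂-transitions p))

  transitions-resp-SamePseudoOrbit : {p q : PseudoOrbit n} → SamePseudoOrbit p q →
                                     transitions p ↭ transitions q
  transitions-resp-SamePseudoOrbit (r , p↭r , rotations) =
    ↭-trans (concatMap-↭ (cyclicPairs ∘ circuitBonds) p↭r) (rotated rotations)
    where
    rotated : ∀ {r q} → Pointwise SameOrbit r q → transitions r ↭ transitions q
    rotated []       = ↭-refl
    rotated (s ∷ ss) = ++⁺ (Rotation⇒↭ (cyclicPairs-Rotation (circuitBonds-Rotation s))) (rotated ss)

  Linked : Bond n × Bond n → Set
  Linked (a , b) = o b ≡ t a

  transitions-Linked : (p : PseudoOrbit n) → All Linked (transitions p)
  transitions-Linked p = All.concat⁺ (All.map⁺ {xs = p} (All.tabulate λ {c} _ → circuit-Linked c))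
    where
    zip-Linked : (as bs : List (Bond n)) → map t as ≡ map o bs → All Linked (zip as bs)
    zip-Linked []       _        _  = []
    zip-Linked (_ ∷ _)  []       _  = []
    zip-Linked (a ∷ as) (b ∷ bs) eq =
      sym (proj₁ (∷-injective eq)) ∷ zip-Linked as bs (proj₂ (∷-injective eq))
    -- consecutive bonds (v_i , v_{i+1}) , (v_{i+1} , v_{i+2}) share the vertex v_{i+1}
    circuit-Linked : (c : List (Fin n)) → All Linked (cyclicPairs (circuitBonds c))
    circuit-Linked c = subst (All Linked) (sym (cyclicPairs≡zip-rotate₁ (circuitBonds c)))
      (zip-Linked (circuitBonds c) (rotate₁ (circuitBonds c)) (begin
        map t (circuitBonds c)              ≡⟨ cong (map t) (circuitBonds≡cyclicPairs c) ⟩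
        map proj₂ (cyclicPairs c)           ≡⟨ map-proj₂-cyclicPairs c ⟩
        rotate₁ c                           ≡⟨ sym (map-proj₁-cyclicPairs (rotate₁ c)) ⟩
        map proj₁ (cyclicPairs (rotate₁ c)) ≡⟨ cong (map proj₁) (cyclicPairs-rotate₁ c) ⟩
        map o (rotate₁ (cyclicPairs c))     ≡⟨ cong (map o ∘ rotate₁) (sym (circuitBonds≡cyclicPairs c)) ⟩
        map o (rotate₁ (circuitBonds c))    ∎))
      where open ≡-Reasoning

  module _ (f : Bond n → Bond n) where

    Follows : PseudoOrbit n → Set
    Follows p = All (Step f) (transitions p)

    Follows-resp-SamePseudoOrbit : {p q : PseudoOrbit n} → SamePseudoOrbit p q → Follows p → Follows q
    Follows-resp-SamePseudoOrbit same = All-resp-↭ (transitions-resp-SamePseudoOrbit same)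

    Follows⇒IsCycles : (p : PseudoOrbit n) → Follows p → All (IsCycle f ∘ circuitBonds) p
    Follows⇒IsCycles p steps = All.map⁻ (All.concat⁻ steps)

    IsCycles⇒Follows : (p : PseudoOrbit n) → All (IsCycle f ∘ circuitBonds) p → Follows p
    IsCycles⇒Follows p cycles = All.concat⁺ (All.map⁺ cycles)

    shared-bond⇒SameOrbit : ∀ {c c′ β bs} → circuitBonds c ≡ β ∷ bs → β ∈ circuitBonds c′ →
                            Unique (circuitBonds c) → Unique (circuitBonds c′) →
                            IsCycle f (circuitBonds c) → IsCycle f (circuitBonds c′) → SameOrbit c c′
    shared-bond⇒SameOrbit {c} {c′} {β} {bs} c-bonds β∈c′ c! c′! c-cycle c′-cycle
      with ∈-cyclicPairs⇒Rotation {xs = c′} (subst (β ∈_) (circuitBonds≡cyclicPairs c′) β∈c′)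
    ... | c″ , (us , vs , refl , refl) , ps , c″-pairs = vs , us , c≡c″ , refl
      where
      c″-bonds : circuitBonds c″ ≡ β ∷ ps
      c″-bonds = trans (circuitBonds≡cyclicPairs c″) c″-pairs
      c′~c″ : Rotation (circuitBonds c′) (circuitBonds c″)
      c′~c″ = circuitBonds-Rotation (us , vs , refl , refl)
      c′↭c″ : circuitBonds c′ ↭ circuitBonds c″
      c′↭c″ = Rotation⇒↭ c′~c″
      bs≡ps : bs ≡ ps
      bs≡ps = IsCycle-unique f β
                (subst Unique c-bonds c!) (subst Unique c″-bonds (Unique-resp-↭ c′↭c″ c′!))
                (subst (IsCycle f) c-bonds c-cycle)
                (subst (IsCycle f) c″-bonds (IsCycle-Rotation f c′~c″ c′-cycle))
      c≡c″ : c ≡ c″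
      c≡c″ = circuitBonds-injective (trans c-bonds (trans (cong (β ∷_) bs≡ps) (sym c″-bonds)))

    IsCycles-rigid : ∀ p {q} → All NonEmpty p → All NonEmpty q →
                     Unique (poBonds p) → poBonds p ↭ poBonds q →
                     All (IsCycle f ∘ circuitBonds) p → All (IsCycle f ∘ circuitBonds) q →
                     SamePseudoOrbit p q
    IsCycles-rigid [] {[]} _ _ _ _ _ _ = [] , ↭-refl , []
    IsCycles-rigid [] {c′ ∷ q} _ (ne ∷ _) _ []↭ _ _ with circuitBonds-nonEmpty ne
    ... | β , bs , c′-bonds =
      ⊥-elim (0≢1+n (trans (↭-length []↭) (cong (length ∘ (_++ poBonds q)) c′-bonds)))
    IsCycles-rigid (c ∷ p) {q} (ne ∷ ne-p) ne-q c++p! c++p↭q (c-cycle ∷ p-cycles) q-cycles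
      with circuitBonds-nonEmpty ne
    ... | β , bs , c-bonds with find (∈-concatMap⁻ circuitBonds {xs = q} β∈q)
      where
      β∈q : β ∈ poBonds q
      β∈q = ∈-resp-↭ c++p↭q (subst (λ bs′ → β ∈ bs′ ++ poBonds p) (sym c-bonds) (here refl))
    ... | c′ , c′∈q , β∈c′ with ∈-∃++ c′∈q
    ... | q₁ , q₂ , refl =
      let r , p↭r , rotations = IsCycles-rigid p ne-p (All.tail (All-resp-↭ q↭ ne-q))
                                  (Unique-++⁻ʳ (circuitBonds c) c++p!) p↭rest p-cycles (All.tail q-cycles′)
          r′ , c∷r↭r′ , rotations′ = Pointwise-↭ʳ (same ∷ rotations) (↭-sym q↭)
      in  r′ , ↭-trans (↭-prep c p↭r) c∷r↭r′ , rotations′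
      where
      q↭ : q₁ ++ c′ ∷ q₂ ↭ c′ ∷ q₁ ++ q₂
      q↭ = shift c′ q₁ q₂
      q-bonds↭ : poBonds (q₁ ++ c′ ∷ q₂) ↭ circuitBonds c′ ++ poBonds (q₁ ++ q₂)
      q-bonds↭ = concatMap-↭ circuitBonds q↭
      q-cycles′ : All (IsCycle f ∘ circuitBonds) (c′ ∷ q₁ ++ q₂)
      q-cycles′ = All-resp-↭ q↭ q-cycles
      c′! : Unique (circuitBonds c′)
      c′! = Unique-++⁻ˡ (circuitBonds c′) (Unique-resp-↭ q-bonds↭ (Unique-resp-↭ c++p↭q c++p!))
      same : SameOrbit c c′
      same = shared-bond⇒SameOrbit c-bonds β∈c′ (Unique-++⁻ˡ (circuitBonds c) c++p!) c′!
               c-cycle (All.head q-cycles′)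
      p↭rest : poBonds p ↭ poBonds (q₁ ++ q₂)
      p↭rest = ++-cancelˡ-↭ (circuitBonds c) (↭-trans c++p↭q (↭-trans q-bonds↭
                 (++⁺ʳ _ (↭-sym (Rotation⇒↭ (circuitBonds-Rotation same))))))

    Follows-rigid : ∀ {p q} → All NonEmpty p → All NonEmpty q → Unique (poBonds p) → poBonds p ↭ poBonds q →
                    Follows p → Follows q → SamePseudoOrbit p q
    Follows-rigid {p} {q} ne-p ne-q p! p↭q p-follows q-follows =
      IsCycles-rigid p ne-p ne-q p! p↭q (Follows⇒IsCycles p p-follows) (Follows⇒IsCycles q q-follows)

  _≟ᵇ_ : DecidableEquality (Bond n)
  _≟ᵇ_ = ≡-dec _≟ᶠ_ _≟ᶠ_

  circuitBonds-map-o : {bs : List (Bond n)} → NonEmpty bs → All Linked (cyclicPairs bs) →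
                       circuitBonds (map o bs) ≡ bs
  circuitBonds-map-o (nonEmpty b bs) = chain b bs b
    where
    chain : ∀ b bs z → All Linked (zip (b ∷ bs) (bs ∷ʳ z)) →
            zip (o b ∷ map o bs) (map o bs ∷ʳ o z) ≡ b ∷ bs
    chain b []        z (linked ∷ [])      = cong (λ v → (o b , v) ∷ []) linked
    chain b (b′ ∷ bs) z (linked ∷ linked′) = cong₂ _∷_ (cong (o b ,_) linked) (chain b′ bs z linked′)

  module _ (E : Graph n) {B : List (Bond n)} (B! : Unique B) (B⊆E : All (IsBondOf E) B)
           (f : Bond n → Bond n) (f-into : ∀ {b} → b ∈ B → f b ∈ B)
           (f-linked : ∀ {b} → b ∈ B → o (f b) ≡ t b) (f-inj : InjectiveOn f B) where

    pseudoOrbit-following : ∃ λ p → PseudoOrbitOn E B p × Follows f p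
    pseudoOrbit-following with cycle-decomposition f _≟ᵇ_ B B! f-into f-inj
    ... | cs , cs↭B , cycles =
      map (map o) cs ,
      (circuits , subst (_↭ B) (sym (poBonds-recovered cs recovered)) cs↭B) ,
      IsCycles⇒Follows f _ cycles′
      where
      cs⊆B : ∀ {bs} → bs ∈ cs → bs ⊆ B
      cs⊆B bs∈ b∈ = ∈-resp-↭ cs↭B (∈-concat⁺′ b∈ bs∈)
      recovered : All (λ bs → circuitBonds (map o bs) ≡ bs) cs
      recovered = All.tabulate λ {bs} bs∈ → let ne , cycle = All.lookup cycles bs∈ in
        circuitBonds-map-o ne (All.tabulate λ {(a , b)} ab∈ →
          trans (cong o (All.lookup cycle ab∈)) (f-linked (cs⊆B bs∈ (proj₁-∈-cyclicPairs ab∈))))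
      poBonds-recovered : ∀ cs → All (λ bs → circuitBonds (map o bs) ≡ bs) cs →
                          poBonds (map (map o) cs) ≡ concat cs
      poBonds-recovered []       []          = refl
      poBonds-recovered (bs ∷ cs) (eq ∷ eqs) = cong₂ _++_ eq (poBonds-recovered cs eqs)
      circuits : IsPseudoOrbit E (map (map o) cs)
      circuits = All.map⁺ (All.tabulate λ {bs} bs∈ →
        map-o-nonEmpty (proj₁ (All.lookup cycles bs∈)) ,
        subst (All (IsBondOf E)) (sym (All.lookup recovered bs∈))
          (All.tabulate λ b∈ → All.lookup B⊆E (cs⊆B bs∈ b∈)))
        where
        map-o-nonEmpty : ∀ {bs} → NonEmpty bs → NonEmpty (map o bs)
        map-o-nonEmpty (nonEmpty b bs) = nonEmpty (o b) (map o bs)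
      cycles′ : All (IsCycle f ∘ circuitBonds) (map (map o) cs)
      cycles′ = All.map⁺ (All.tabulate λ bs∈ →
        subst (IsCycle f) (sym (All.lookup recovered bs∈)) (proj₂ (All.lookup cycles bs∈)))

  Follows-agree : ∀ {f g p b} → Follows f p → Follows g p → b ∈ poBonds p → f b ≡ g b
  Follows-agree {p = p} f-steps g-steps b∈
    with ∈-map⁻ proj₁ (subst (_ ∈_) (sym (map-proj₁-transitions p)) b∈)
  ... | (b , b′) , bb′∈ , refl = trans (sym (All.lookup f-steps bb′∈)) (All.lookup g-steps bb′∈)

  Follows-cong : ∀ {f g p} → (∀ {b} → b ∈ poBonds p → f b ≡ g b) → Follows f p → Follows g p
  Follows-cong {p = p} f≗g f-steps = All.tabulate λ {(b , b′)} bb′∈ →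
    trans (All.lookup f-steps bb′∈) (f≗g (subst (_ ∈_) (map-proj₁-transitions p) (∈-map⁺ proj₁ bb′∈)))

-- Routing bonds through the vertices
module Routing {n : ℕ} (B : List (Bond n)) (B! : Unique B) (balanced : oB B ↭ tB B)
               (at-most-twice : ∀ v → occ v (oB B) ≤ 2) where

  In Out : Fin n → List (Bond n)
  In  y = filter (λ b → y ≟ᶠ t b) B
  Out y = filter (λ b → y ≟ᶠ o b) B

  length-Out : ∀ y → length (Out y) ≡ occ y (oB B)
  length-Out y = length-filter-map y o B

  length-In : ∀ y → length (In y) ≡ occ y (oB B)
  length-In y = trans (length-filter-map y t B) (↭-length (filter-↭ (y ≟ᶠ_) (↭-sym balanced)))

  ∈-In⁺ : ∀ {b} → b ∈ B → b ∈ In (t b)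
  ∈-In⁺ b∈ = ∈-filter⁺ _ b∈ refl

  ∈-In⁻ : ∀ {y b} → b ∈ In y → b ∈ B × y ≡ t b
  ∈-In⁻ = ∈-filter⁻ _

  ∈-Out⁺ : ∀ {y b} → b ∈ B → y ≡ o b → b ∈ Out y
  ∈-Out⁺ = ∈-filter⁺ _

  ∈-Out⁻ : ∀ {y b} → b ∈ Out y → b ∈ B × y ≡ o b
  ∈-Out⁻ = ∈-filter⁻ _

  data Junction (y : Fin n) : Set where
    simple : ∀ {i o′} → In y ≡ [ i ] → Out y ≡ [ o′ ] → occ y (oB B) ≡ 1 → Junction y
    double : ∀ {i₁ i₂ o₁ o₂} → In y ≡ i₁ ∷ i₂ ∷ [] → Out y ≡ o₁ ∷ o₂ ∷ [] → occ y (oB B) ≡ 2 →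
             i₁ ≢ i₂ → o₁ ≢ o₂ → Junction y

  junction : ∀ y → 1 ≤ occ y (oB B) → Junction y
  junction y 1≤occ with occ y (oB B) in occ≡ | length-In y | length-Out y | at-most-twice y
  ... | 1 | In-1 | Out-1 | _ with length≡1 In-1 | length≡1 Out-1
  ...   | _ , In≡ | _ , Out≡ = simple In≡ Out≡ occ≡
  junction y 1≤occ | 2 | In-2 | Out-2 | _ with length≡2 In-2 | length≡2 Out-2
  ...   | _ , _ , In≡ | _ , _ , Out≡ =
    double In≡ Out≡ occ≡ (distinct (subst Unique In≡ In!)) (distinct (subst Unique Out≡ Out!))
    where
    In! : Unique (In y)
    In! = Unique.filter⁺ _ B!
    Out! : Unique (Out y)
    Out! = Unique.filter⁺ _ B!
    distinct : ∀ {x x′ : Bond n} → Unique (x ∷ x′ ∷ []) → x ≢ x′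
    distinct ((x≢x′ ∷ []) ∷ _) = x≢x′
  junction y 1≤occ | suc (suc (suc _)) | _ | _ | s≤s (s≤s ())

  junction-t : ∀ {b} → b ∈ B → Junction (t b)
  junction-t b∈ = junction _ (subst (1 ≤_) (length-In _) (nonempty (∈-In⁺ b∈)))
    where
    nonempty : ∀ {b} {bs : List (Bond n)} → b ∈ bs → 1 ≤ length bs
    nonempty (here _)  = s≤s z≤n
    nonempty (there _) = s≤s z≤n

  -- s = true crosses the two bonds: the first incoming bond continues along the second outgoing one.
  -- The last clause is a junk value: for b ∈ B the list Out (t b) is never empty.
  route : Bool → Bond n → List (Bond n) → List (Bond n) → Bond n
  route s b (i₁ ∷ _ ∷ _) (o₁ ∷ o₂ ∷ _) =
    if does (b ≟ᵇ i₁) then (if s then o₂ else o₁) else (if s then o₁ else o₂)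
  route s b _            (o′ ∷ _)      = o′
  route s b _            []            = b

  next : (Fin n → Bool) → Bond n → Bond n
  next σ b = route (σ (t b)) b (In (t b)) (Out (t b))

  module _ (σ : Fin n → Bool) {y : Fin n} where

    next-simple : ∀ {i o′} → In y ≡ [ i ] → Out y ≡ [ o′ ] → next σ i ≡ o′
    next-simple {i} In≡ Out≡ with ∈-In⁻ {b = i} (subst (_ ∈_) (sym In≡) (here refl))
    ... | _ , refl rewrite In≡ | Out≡ = refl

    next-first : ∀ {i₁ i₂ o₁ o₂} → In y ≡ i₁ ∷ i₂ ∷ [] → Out y ≡ o₁ ∷ o₂ ∷ [] →
                 next σ i₁ ≡ (if σ y then o₂ else o₁)
    next-first {i₁} In≡ Out≡ with ∈-In⁻ {b = i₁} (subst (_ ∈_) (sym In≡) (here refl))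
    ... | _ , refl rewrite In≡ | Out≡ | dec-true (i₁ ≟ᵇ i₁) refl = refl

    next-second : ∀ {i₁ i₂ o₁ o₂} → In y ≡ i₁ ∷ i₂ ∷ [] → Out y ≡ o₁ ∷ o₂ ∷ [] → i₁ ≢ i₂ →
                  next σ i₂ ≡ (if σ y then o₁ else o₂)
    next-second {i₁} {i₂} In≡ Out≡ i₁≢i₂ with ∈-In⁻ {b = i₂} (subst (_ ∈_) (sym In≡) (there (here refl)))
    ... | _ , refl rewrite In≡ | Out≡ | dec-false (i₂ ≟ᵇ i₁) (i₁≢i₂ ∘ sym) = refl

  next-∈-Out : ∀ σ {b} → b ∈ B → next σ b ∈ Out (t b)
  next-∈-Out σ {b} b∈ with junction-t b∈
  ... | simple In≡ Out≡ _ with subst (b ∈_) In≡ (∈-In⁺ b∈)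
  ...   | here refl = subst₂ _∈_ (sym (next-simple σ In≡ Out≡)) (sym Out≡) (here refl)
  next-∈-Out σ {b} b∈ | double In≡ Out≡ _ i₁≢i₂ _ with ∈-pair (subst (b ∈_) In≡ (∈-In⁺ b∈))
  ... | inj₁ refl = subst₂ _∈_ (sym (next-first σ In≡ Out≡)) (sym Out≡)
                      (if-∈ (σ (t b)) (there (here refl)) (here refl))
  ... | inj₂ refl = subst₂ _∈_ (sym (next-second σ In≡ Out≡ i₁≢i₂)) (sym Out≡)
                      (if-∈ (σ (t b)) (here refl) (there (here refl)))

  next-∈ : ∀ σ {b} → b ∈ B → next σ b ∈ B
  next-∈ σ b∈ = proj₁ (∈-Out⁻ (next-∈-Out σ b∈))

  next-linked : ∀ σ {b} → b ∈ B → o (next σ b) ≡ t b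
  next-linked σ b∈ = sym (proj₂ (∈-Out⁻ (next-∈-Out σ b∈)))

  next-injective : ∀ σ → InjectiveOn (next σ) B
  next-injective σ {a} {b} a∈ b∈ eq
    with junction-t a∈ | ∈-In⁺ a∈ | subst (λ y → b ∈ In y) (sym t-a≡t-b) (∈-In⁺ b∈)
    where
    t-a≡t-b : t a ≡ t b
    t-a≡t-b = trans (sym (next-linked σ a∈)) (trans (cong o eq) (next-linked σ b∈))
  ... | simple In≡ _ _ | a∈In | b∈In with subst (a ∈_) In≡ a∈In | subst (b ∈_) In≡ b∈In
  ...   | here refl | here refl = refl
  next-injective σ {a} {b} a∈ b∈ eq | double In≡ Out≡ _ i₁≢i₂ o₁≢o₂ | a∈In | b∈In
    with ∈-pair (subst (a ∈_) In≡ a∈In) | ∈-pair (subst (b ∈_) In≡ b∈In)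
  ... | inj₁ refl | inj₁ refl = refl
  ... | inj₂ refl | inj₂ refl = refl
  ... | inj₁ refl | inj₂ refl = ⊥-elim (if-swap-≢ (σ (t a)) o₁≢o₂
    (trans (sym (next-first σ In≡ Out≡)) (trans eq (next-second σ In≡ Out≡ i₁≢i₂))))
  ... | inj₂ refl | inj₁ refl = ⊥-elim (if-swap-≢ (σ (t a)) o₁≢o₂
    (trans (sym (next-first σ In≡ Out≡)) (trans (sym eq) (next-second σ In≡ Out≡ i₁≢i₂))))

  next-cong : ∀ {σ σ′ b} → b ∈ B → (occ (t b) (oB B) ≡ 2 → σ (t b) ≡ σ′ (t b)) → next σ b ≡ next σ′ b
  next-cong {σ} {σ′} {b} b∈ agree with junction-t b∈
  ... | simple In≡ Out≡ _ with subst (b ∈_) In≡ (∈-In⁺ b∈)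
  ...   | here refl = trans (next-simple σ In≡ Out≡) (sym (next-simple σ′ In≡ Out≡))
  next-cong {σ} {σ′} {b} b∈ agree | double _ _ occ≡2 _ _ =
    cong (λ s → route s b (In (t b)) (Out (t b))) (agree occ≡2)

  next-separates : ∀ {σ σ′ y} → occ y (oB B) ≡ 2 → σ y ≢ σ′ y → ∃ λ b → b ∈ B × next σ b ≢ next σ′ b
  next-separates {σ} {σ′} {y} occ≡2 σ≢σ′ with junction y (subst (1 ≤_) (sym occ≡2) (s≤s z≤n))
  ... | simple _ _ occ≡1 = ⊥-elim (1+n≢n (trans (sym occ≡2) occ≡1))
  ... | double {i₁} In≡ Out≡ _ _ o₁≢o₂ =
    i₁ , proj₁ (∈-In⁻ (subst (i₁ ∈_) (sym In≡) (here refl))) ,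
    λ eq → if-≢ o₁≢o₂ σ≢σ′ (trans (sym (next-first σ In≡ Out≡)) (trans eq (next-first σ′ In≡ Out≡)))

  module _ (p : PseudoOrbit n) (p↭B : poBonds p ↭ B) where

    private
      T = transitions p
    open DecMembership (≡-dec (_≟ᵇ_ {n}) (_≟ᵇ_ {n})) using (_∈?_)

    firsts↭B : map proj₁ T ↭ B
    firsts↭B = subst (_↭ B) (sym (map-proj₁-transitions p)) p↭B

    seconds↭B : map proj₂ T ↭ B
    seconds↭B = ↭-trans (map-proj₂-transitions p) p↭B

    T-inj₁ : InjectiveOn proj₁ T
    T-inj₁ = Unique-map⇒InjectiveOn proj₁ (Unique-resp-↭ (↭-sym firsts↭B) B!)

    T-inj₂ : InjectiveOn proj₂ T
    T-inj₂ = Unique-map⇒InjectiveOn proj₂ (Unique-resp-↭ (↭-sym seconds↭B) B!)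

    successor : ∀ {b} → b ∈ B → ∃ λ b′ → (b , b′) ∈ T
    successor b∈ with ∈-map⁻ proj₁ (∈-resp-↭ (↭-sym firsts↭B) b∈)
    ... | (_ , b′) , bb′∈ , refl = b′ , bb′∈

    transition-bonds : ∀ {b b′} → (b , b′) ∈ T → b ∈ In (t b) × b′ ∈ Out (t b)
    transition-bonds bb′∈ =
      ∈-In⁺ (∈-resp-↭ firsts↭B (∈-map⁺ proj₁ bb′∈)) ,
      ∈-Out⁺ (∈-resp-↭ seconds↭B (∈-map⁺ proj₂ bb′∈)) (sym (All.lookup (transitions-Linked p) bb′∈))

    crossing : List (Bond n) → List (Bond n) → Bool
    crossing (i₁ ∷ _) (o₁ ∷ _) = not (does ((i₁ , o₁) ∈? T))
    crossing _        _        = false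

    switch : Fin n → Bool
    switch y = crossing (In y) (Out y)

    module _ {y i₁ i₂ o₁ o₂} (In≡ : In y ≡ i₁ ∷ i₂ ∷ []) (Out≡ : Out y ≡ o₁ ∷ o₂ ∷ []) where

      first-routed : (i₁ , (if switch y then o₂ else o₁)) ∈ T
      first-routed = subst (λ s → (i₁ , (if s then o₂ else o₁)) ∈ T) (sym (cong₂ crossing In≡ Out≡))
                       (routed ((i₁ , o₁) ∈? T))
        where
        routed : (d : Dec ((i₁ , o₁) ∈ T)) → (i₁ , (if not (does d) then o₂ else o₁)) ∈ T
        routed (yes i₁o₁∈) = i₁o₁∈
        routed (no  i₁o₁∉) with ∈-In⁻ (subst (i₁ ∈_) (sym In≡) (here refl))
        ... | i₁∈B , refl with successor i₁∈B
        ... | b′ , i₁b′∈ with ∈-pair (subst (b′ ∈_) Out≡ (proj₂ (transition-bonds i₁b′∈)))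
        ...   | inj₁ refl = ⊥-elim (i₁o₁∉ i₁b′∈)
        ...   | inj₂ refl = i₁b′∈

      -- i₁ continues as first-routed says, and T being injective in both components, i₂ takes the other bond.
      double-step : ∀ {b b′} → (b , b′) ∈ T → b ∈ i₁ ∷ i₂ ∷ [] → b′ ∈ o₁ ∷ o₂ ∷ [] → i₁ ≢ i₂ →
                    b′ ≡ next switch b
      double-step {b′ = b′} bb′∈ b∈ b′∈ i₁≢i₂ with ∈-pair b∈
      ... | inj₁ refl = trans (cong proj₂ (T-inj₁ bb′∈ first-routed refl)) (sym (next-first switch In≡ Out≡))
      ... | inj₂ refl = trans (if-other (switch y) b′∈ b′≢u) (sym (next-second switch In≡ Out≡ i₁≢i₂))
        where
        b′≢u : b′ ≢ (if switch y then o₂ else o₁)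
        b′≢u b′≡u = i₁≢i₂ (cong proj₁ (T-inj₂ first-routed bb′∈ (sym b′≡u)))

    Follows-next-switch : Follows (next switch) p
    Follows-next-switch = All.tabulate λ {(b , b′)} bb′∈ → step bb′∈ (transition-bonds bb′∈)
      where
      step : ∀ {b b′} → (b , b′) ∈ T → b ∈ In (t b) × b′ ∈ Out (t b) → b′ ≡ next switch b
      step {b} {b′} bb′∈ (b∈In , b′∈Out) with junction-t (proj₁ (∈-In⁻ b∈In))
      ... | simple In≡ Out≡ _ with subst (b ∈_) In≡ b∈In | subst (b′ ∈_) Out≡ b′∈Out
      ...   | here refl | here refl = sym (next-simple switch In≡ Out≡)
      step bb′∈ (b∈In , b′∈Out) | double In≡ Out≡ _ i₁≢i₂ _ =
        double-step In≡ Out≡ bb′∈ (subst (_ ∈_) In≡ b∈In) (subst (_ ∈_) Out≡ b′∈Out) i₁≢i₂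

-- Switch settings
module _ {A : Set} (_≟_ : DecidableEquality A) where

  _[_↦_] : (A → Bool) → A → Bool → A → Bool
  (σ [ w ↦ s ]) y = if does (y ≟ w) then s else σ y

  AgreeOn : List A → (A → Bool) → (A → Bool) → Set
  AgreeOn ws σ σ′ = ∀ {y} → y ∈ ws → σ y ≡ σ′ y

  SeparatedOn : List A → (A → Bool) → (A → Bool) → Set
  SeparatedOn ws σ σ′ = ∃ λ y → y ∈ ws × σ y ≢ σ′ y

  update-≡ : ∀ σ w s → (σ [ w ↦ s ]) w ≡ s
  update-≡ σ w s rewrite dec-true (w ≟ w) refl = refl

  update-≢ : ∀ σ {w y} s → y ≢ w → (σ [ w ↦ s ]) y ≡ σ y
  update-≢ σ {w} {y} s y≢w rewrite dec-false (y ≟ w) y≢w = refl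

  switches : List A → List (A → Bool)
  switches []       = [ (λ _ → false) ]
  switches (w ∷ ws) = map (_[ w ↦ true ]) (switches ws) ++ map (_[ w ↦ false ]) (switches ws)

  length-switches : ∀ ws → length (switches ws) ≡ 2 ^ length ws
  length-switches []       = refl
  length-switches (w ∷ ws) = begin
    length (map (_[ w ↦ true ]) (switches ws) ++ map (_[ w ↦ false ]) (switches ws))
      ≡⟨ length-++ (map (_[ w ↦ true ]) (switches ws)) ⟩
    length (map (_[ w ↦ true ]) (switches ws)) + length (map (_[ w ↦ false ]) (switches ws))
      ≡⟨ cong₂ _+_ (length-map _ (switches ws)) (length-map _ (switches ws)) ⟩
    length (switches ws) + length (switches ws)
      ≡⟨ cong₂ _+_ (length-switches ws) (trans (length-switches ws) (sym (+-identityʳ _))) ⟩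
    2 ^ length (w ∷ ws) ∎
    where open ≡-Reasoning

  switches-separated : ∀ {ws} → Unique ws → AllPairs (SeparatedOn ws) (switches ws)
  switches-separated {[]}     []         = All.[] ∷ []
  switches-separated {w ∷ ws} (w∉ ∷ ws!) =
    AllPairs.++⁺ (AllPairs.map⁺ (AllPairs.map (keep true) separated))
                 (AllPairs.map⁺ (AllPairs.map (keep false) separated))
                 (All.map⁺ (All.universal (λ σ → All.map⁺ (All.universal (λ σ′ → at-w σ σ′) _)) _))
    where
    separated = switches-separated ws!
    keep : ∀ s {σ σ′} → SeparatedOn ws σ σ′ → SeparatedOn (w ∷ ws) (σ [ w ↦ s ]) (σ′ [ w ↦ s ])
    keep s {σ} {σ′} (y , y∈ , σy≢σ′y) = y , there y∈ , λ eq →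
      σy≢σ′y (trans (sym (update-≢ σ s y≢w)) (trans eq (update-≢ σ′ s y≢w)))
      where
      y≢w : y ≢ w
      y≢w y≡w = All.lookup w∉ y∈ (sym y≡w)
    at-w : ∀ σ σ′ → SeparatedOn (w ∷ ws) (σ [ w ↦ true ]) (σ′ [ w ↦ false ])
    at-w σ σ′ = w , here refl , λ eq →
      true≢false (trans (sym (update-≡ σ w true)) (trans eq (update-≡ σ′ w false)))
      where
      true≢false : true ≢ false
      true≢false ()

  AgreeOn-update : ∀ {w ws σ σ′ s} → σ w ≡ s → AgreeOn ws σ σ′ → AgreeOn (w ∷ ws) σ (σ′ [ w ↦ s ])
  AgreeOn-update {w} σw≡s agree {y} y∈ with y ≟ w
  ... | yes refl = σw≡s
  ... | no  y≢w with y∈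
  ...   | here y≡w   = ⊥-elim (y≢w y≡w)
  ...   | there y∈ws = agree y∈ws

  switches-complete : ∀ ws σ → Any (AgreeOn ws σ) (switches ws)
  switches-complete []       σ = here (λ ())
  switches-complete (w ∷ ws) σ with σ w in σw≡
  ... | true  = Any.++⁺ˡ (Any.map⁺ (Any.map (AgreeOn-update σw≡) (switches-complete ws σ)))
  ... | false = Any.++⁺ʳ _ (Any.map⁺ (Any.map (AgreeOn-update σw≡) (switches-complete ws σ)))

module PseudoOrbitsOn {n : ℕ} (E : Graph n) (B : List (Bond n)) (B⊆E : All (IsBondOf E) B)
                      (B! : Unique B) (balanced : oB B ↭ tB B)
                      (at-most-twice : ∀ v → occ v (oB B) ≤ 2) where

  open Routing B B! balanced at-most-twice

  twice? : ∀ v → Dec (occ v (oB B) ≡ 2)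
  twice? v = occ v (oB B) ≟ 2

  W : List (Fin n)
  W = filter twice? (allFin n)

  W! : Unique W
  W! = Unique.filter⁺ twice? (Unique.allFin⁺ n)

  realise : (σ : Fin n → Bool) → ∃ λ p → PseudoOrbitOn E B p × Follows (next σ) p
  realise σ = pseudoOrbit-following E B! B⊆E (next σ) (next-∈ σ) (next-linked σ) (next-injective σ)

  pseudoOrbit : (Fin n → Bool) → PseudoOrbit n
  pseudoOrbit = proj₁ ∘ realise

  pseudoOrbit-on : ∀ σ → PseudoOrbitOn E B (pseudoOrbit σ)
  pseudoOrbit-on = proj₁ ∘ proj₂ ∘ realise

  pseudoOrbit-follows : ∀ σ → Follows (next σ) (pseudoOrbit σ)
  pseudoOrbit-follows = proj₂ ∘ proj₂ ∘ realise

  separated⇒distinct : ∀ {σ σ′} → SeparatedOn _≟ᶠ_ W σ σ′ →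
                       ¬ SamePseudoOrbit (pseudoOrbit σ) (pseudoOrbit σ′)
  separated⇒distinct {σ} {σ′} (y , y∈W , σy≢σ′y) same
    with next-separates (proj₂ (∈-filter⁻ twice? {xs = allFin n} y∈W)) σy≢σ′y
  ... | b , b∈B , next-differs = next-differs (Follows-agree {p = pseudoOrbit σ′}
    (Follows-resp-SamePseudoOrbit (next σ) same (pseudoOrbit-follows σ))
    (pseudoOrbit-follows σ′)
    (∈-resp-↭ (↭-sym (proj₂ (pseudoOrbit-on σ′))) b∈B))

  AgreeOn-W⇒next-agree : ∀ {σ σ′} → AgreeOn _≟ᶠ_ W σ σ′ → ∀ {b} → b ∈ B → next σ b ≡ next σ′ b
  AgreeOn-W⇒next-agree {σ} {σ′} agree b∈B =
    next-cong {σ} {σ′} b∈B (λ occ≡2 → agree (∈-filter⁺ twice? (∈-allFin _) occ≡2))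

  complete : ∀ {p} → PseudoOrbitOn E B p → Any (SamePseudoOrbit p) (map pseudoOrbit (switches _≟ᶠ_ W))
  complete {p} (p-circuits , p↭B) = Any.map⁺ (Any.map same (switches-complete _≟ᶠ_ W (switch p p↭B)))
    where
    same : ∀ {σ} → AgreeOn _≟ᶠ_ W (switch p p↭B) σ → SamePseudoOrbit p (pseudoOrbit σ)
    same {σ} agree = Follows-rigid (next σ)
      (All.map proj₁ p-circuits) (All.map proj₁ (proj₁ (pseudoOrbit-on σ)))
      (Unique-resp-↭ (↭-sym p↭B) B!) (↭-trans p↭B (↭-sym (proj₂ (pseudoOrbit-on σ))))
      (Follows-cong {p = p} (AgreeOn-W⇒next-agree agree ∘ ∈-resp-↭ p↭B) (Follows-next-switch p p↭B))
      (pseudoOrbit-follows σ)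

lemma3 : ∀ (n : ℕ) (E : Graph n) (B : List (Bond n))
         → All (IsBondOf E) B
         → Unique B
         → B ≢ []
         → oB B ↭ tB B
         → (∀ (v : Fin n) → occ v (oB B) ≤ 2)
         → Σ (List (PseudoOrbit n)) λ L →
             (length L ≡ 2 ^ twiceCount B)
             × All (PseudoOrbitOn E B) L
             × AllPairs (λ p q → ¬ SamePseudoOrbit p q) L
             × (∀ p → PseudoOrbitOn E B p → Any (SamePseudoOrbit p) L)
lemma3 n E B B⊆E B! _ balanced at-most-twice =
  map pseudoOrbit (switches _≟ᶠ_ W) ,
  trans (length-map pseudoOrbit (switches _≟ᶠ_ W)) (length-switches _≟ᶠ_ W) ,
  All.map⁺ (All.universal pseudoOrbit-on _) ,
  AllPairs.map⁺ (AllPairs.map separated⇒distinct (switches-separated _≟ᶠ_ W!)) ,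
  λ _ → complete
  where open PseudoOrbitsOn E B B⊆E B! balanced at-most-twice
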